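{- Let $\mathscr G$ be a closed oligomorphic permutation group on a set $G$, and let $\mathscr M\subseteq G^G$ be a non-empty closed transformation semigroup which is invariant under $\mathscr G$ and which contains a function that is canonical with respect to $\mathscr G$. Then $\mathscr M$ contains a function that is range-rigid with respect to $\mathscr G$.
   Context: $G$ is countable; $G^G$ carries the topology of pointwise convergence ($G$ discrete). $\mathscr G$ closed means closed in the symmetric group on $G$; oligomorphic means finitely many orbits on $G^n$ for each $n\ge1$. $\mathscr M$ closed means closed in $G^G$; invariant under $\mathscr G$ means $\alpha\circ m\in\mathscr M$ and $m\circ\alpha\in\mathscr M$ for all $\alpha\in\mathscr G$, $m\in\mathscr M$. A function $g\colon G\to G$ is canonical with respect to $\mathscr G$ if for every $\beta\in\mathscr G$, $g$ lies in the closure of $\{\alpha\circ g\circ\beta:\alpha\in\mathscr G\}$ (equivalently, $g$ maps each orbit of $\mathscr G$ on $n$-tuples into a single orbit). It is range-rigid with respect to $\mathscr G$ if for every $\beta\in\mathscr G$, $g$ lies in the closure of $\{\alpha\circ g\circ\beta\circ g:\alpha\in\mathscr G\}$ (equivalently, every orbit on $n$-tuples containing a tuple from the range of $g$ is mapped into itself by $g$). -}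

module Defs where

open import Data.Nat using (ℕ; _≤_)
open import Data.Fin using (Fin)
open import Data.List using (List)
open import Data.List.Membership.Propositional using (_∈_)
open import Data.Product using (Σ; ∃; _×_)
open import Function using (_∘_; id)
open import Function.Definitions using (Injective)
open import Relation.Binary.PropositionalEquality using (_≡_; _≗_)

Countable : Set → Set
Countable G = Σ (G → ℕ) λ e → Injective _≡_ _≡_ e

FunSet : Set → Set₁
FunSet G = (G → G) → Set

-- Topology of pointwise convergence (G discrete): g lies in the closure of S
-- iff every finite F ⊆ G admits some s ∈ S agreeing with g on F.
InClosure : {G : Set} → FunSet G → (G → G) → Set
InClosure {G} S g = (F : List G) → Σ (G → G) λ s → S s × ((x : G) → x ∈ F → s x ≡ g x)

IsPerm : {G : Set} → (G → G) → Set
IsPerm {G} f = Σ (G → G) λ h → ((x : G) → f (h x) ≡ x) × ((x : G) → h (f x) ≡ x)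

record IsPermGroup {G : Set} (𝒢 : FunSet G) : Set where
  field
    perm    : ∀ α → 𝒢 α → IsPerm α
    has-id  : 𝒢 id
    comp    : ∀ α β → 𝒢 α → 𝒢 β → 𝒢 (α ∘ β)
    inverse : ∀ α → 𝒢 α → Σ (G → G) λ β → 𝒢 β × (α ∘ β ≗ id) × (β ∘ α ≗ id)

-- 𝒢 is closed in the symmetric group on G (subspace topology of G^G).
ClosedPermGroup : {G : Set} → FunSet G → Set
ClosedPermGroup {G} 𝒢 = IsPermGroup 𝒢 × ((π : G → G) → IsPerm π → InClosure 𝒢 π → 𝒢 π)

SameOrbit : {G : Set} → FunSet G → {n : ℕ} → (Fin n → G) → (Fin n → G) → Set
SameOrbit {G} 𝒢 s t = Σ (G → G) λ α → 𝒢 α × (α ∘ s ≗ t)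

-- Oligomorphic: for each n ≥ 1, finitely many orbits on G^n
-- (a finite list of representatives meets every orbit).
Oligomorphic : {G : Set} → FunSet G → Set
Oligomorphic {G} 𝒢 = (n : ℕ) → 1 ≤ n →
  Σ (List (Fin n → G)) λ reps → (t : Fin n → G) → Σ (Fin n → G) λ r → r ∈ reps × SameOrbit 𝒢 r t

Closed : {G : Set} → FunSet G → Set
Closed {G} ℳ = (g : G → G) → InClosure ℳ g → ℳ g

IsTransSemigroup : {G : Set} → FunSet G → Set
IsTransSemigroup ℳ = ∀ f g → ℳ f → ℳ g → ℳ (f ∘ g)

NonEmpty : {G : Set} → FunSet G → Set
NonEmpty {G} ℳ = Σ (G → G) ℳ

Invariant : {G : Set} → FunSet G → FunSet G → Set
Invariant 𝒢 ℳ = ∀ α m → 𝒢 α → ℳ m → ℳ (α ∘ m) × ℳ (m ∘ α)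

Canonical : {G : Set} → FunSet G → (G → G) → Set
Canonical {G} 𝒢 g = (β : G → G) → 𝒢 β →
  InClosure (λ h → Σ (G → G) λ α → 𝒢 α × (h ≗ α ∘ g ∘ β)) g

RangeRigid : {G : Set} → FunSet G → (G → G) → Set
RangeRigid {G} 𝒢 g = (β : G → G) → 𝒢 β →
  InClosure (λ h → Σ (G → G) λ α → 𝒢 α × (h ≗ α ∘ g ∘ β ∘ g)) g

-- A canonical g preserves the orbits of 𝒢 on n-tuples, and so does every power of g; it
-- therefore acts on the finitely many n-orbits, and a suitable power of it acts idempotently
-- there.  For an orbit-preserving k, idempotence on n-orbits already gives range-rigidity on
-- n-element sets: k ∘ γ ∘ k ∘ t lies in the orbit of k ∘ k ∘ t, i.e. of k ∘ t.  Iterating,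
-- we get k_N ∈ ℳ (a power of k_{N-1}) idempotent on n-orbits for every n ≤ N.  Along an
-- enumeration a₀, a₁, … of G, k_{N+2} and k_{N+1} agree on (a₀, …, a_N) up to some γ_N ∈ 𝒢,
-- so the functions α_N ∘ k_{N+1} with α_{N+1} = α_N ∘ γ_N stabilise pointwise.  Their limit h
-- lies in the closed, 𝒢-invariant ℳ and agrees on each finite set with some α_N ∘ k_{N+1},
-- which makes it range-rigid.

module Submission where

open import Defs
open import Level using (0ℓ)
open import Axiom.ExcludedMiddle using (ExcludedMiddle)
open import Data.Product using (Σ; _×_; _,_; proj₁; proj₂)
open import Data.Nat
  using (ℕ; zero; suc; _+_; _*_; _∸_; _≤_; _≤′_; ≤′-refl; ≤′-step; z≤n; s≤s; _!; NonZero; >-nonZero; pred)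
open import Data.Nat.Properties
open import Data.Nat.Divisibility using (_∣_; divides; ∣-trans; m∣m*n; m≤n⇒m!∣n!)
open import Data.Fin using (Fin; toℕ; fromℕ<)
open import Data.Fin.Properties using (pigeonhole; toℕ≤pred[n]; toℕ-fromℕ<)
open import Data.List using (List; length; lookup; tabulate; map; _++_)
open import Data.List.Membership.Propositional using (_∈_)
open import Data.List.Membership.Propositional.Properties
  using (∈-tabulate⁺; ∈-map⁺; ∈-++⁺ˡ; ∈-++⁺ʳ)
open import Data.List.Relation.Unary.Any using (index)
import Data.List.Relation.Unary.All as All
open import Data.List.Extrema.Nat using (max; xs≤max; ⊥≤max)
open import Data.List.Relation.Unary.Any.Properties using (lookup-index)
open import Data.Empty using (⊥-elim)
open import Data.Sum using (inj₁; inj₂)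
open import Function using (_∘_; id)
open import Function.Definitions using (Injective)
open import Relation.Nullary using (yes; no)
open import Relation.Binary.Bundles using (Setoid)
import Relation.Binary.Reasoning.Setoid
open import Relation.Binary.PropositionalEquality as ≡ using (_≡_; _≗_; cong)
open import Algebra.Properties.CommutativeSemigroup +-commutativeSemigroup using (x∙yz≈y∙xz)

m≤n⇒m∣n! : ∀ {m n} .{{_ : NonZero m}} → m ≤ n → m ∣ n !
m≤n⇒m∣n! {suc m} m≤n = ∣-trans (m∣m*n (m !)) (m≤n⇒m!∣n! m≤n)

n≤n! : ∀ n → n ≤ n !
n≤n! zero    = z≤n
n≤n! (suc n) = m≤m*n (suc n) (n !) {{n !≢0}}

module _ {c ℓ} (S : Setoid c ℓ) where
  open Setoid S
  open import Relation.Binary.Reasoning.Setoid S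

  ShiftInvariant : (ℕ → Carrier) → Set ℓ
  ShiftInvariant u = ∀ d {i j} → u i ≈ u j → u (d + i) ≈ u (d + j)

  module _ {u : ℕ → Carrier} (shift : ShiftInvariant u) {i d : ℕ} (period : u (d + i) ≈ u i)
    where

    periodic : ∀ {z} → i ≤ z → u (d + z) ≈ u z
    periodic {z} i≤z = begin
      u (d + z)             ≡⟨ cong (λ m → u (d + m)) (m∸n+n≡m i≤z) ⟨
      u (d + (z ∸ i + i))   ≡⟨ cong u (x∙yz≈y∙xz d (z ∸ i) i) ⟩
      u (z ∸ i + (d + i))   ≈⟨ shift (z ∸ i) period ⟩
      u (z ∸ i + i)         ≡⟨ cong u (m∸n+n≡m i≤z) ⟩
      u z                   ∎

    periodic-multiple : ∀ c {z} → i ≤ z → u (c * d + z) ≈ u z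
    periodic-multiple zero    i≤z = refl
    periodic-multiple (suc c) {z} i≤z = begin
      u (d + c * d + z)     ≡⟨ cong u (+-assoc d (c * d) z) ⟩
      u (d + (c * d + z))   ≈⟨ periodic (≤-trans i≤z (m≤n+m z (c * d))) ⟩
      u (c * d + z)         ≈⟨ periodic-multiple c i≤z ⟩
      u z                   ∎

  u[n!+n!]≈u[n!] : ∀ {u} → ShiftInvariant u → ∀ {n} (cls : Carrier → Fin n) →
                   (∀ {x y} → cls x ≡ cls y → x ≈ y) → u (n ! + n !) ≈ u (n !)
  u[n!+n!]≈u[n!] {u} shift {n} cls sound
    -- pigeonhole on u 0, …, u n: u is periodic from some i ≤ n on, with a period d ≤ n, d ∣ n!
    with i , j , i<j , same ← pigeonhole (n<1+n n) (λ i → cls (u (toℕ i)))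
    with divides c n!≡cd ← m≤n⇒m∣n! {toℕ j ∸ toℕ i} {{>-nonZero (m<n⇒0<n∸m i<j)}}
                                 (≤-trans (m∸n≤m (toℕ j) (toℕ i)) (toℕ≤pred[n] j)) = begin
    u (n ! + n !)     ≡⟨ cong (λ m → u (m + n !)) n!≡cd ⟩
    u (c * d + n !)   ≈⟨ periodic-multiple shift period c (≤-trans (toℕ≤pred[n] i) (n≤n! n)) ⟩
    u (n !)           ∎
    where
    d = toℕ j ∸ toℕ i
    period : u (d + toℕ i) ≈ u (toℕ i)
    period = begin
      u (d + toℕ i)   ≡⟨ cong u (m∸n+n≡m (<⇒≤ i<j)) ⟩
      u (toℕ j)       ≈⟨ sym (sound same) ⟩
      u (toℕ i)       ∎

stationary : ∀ {a} {A : Set a} (u : ℕ → A) {n₀} → (∀ {N} → n₀ ≤ N → u (suc N) ≡ u N) →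
             ∀ {M} → n₀ ≤ M → u M ≡ u n₀
stationary u {n₀} step n₀≤M = go (≤⇒≤′ n₀≤M)
  where
  go : ∀ {M} → n₀ ≤′ M → u M ≡ u n₀
  go ≤′-refl         = ≡.refl
  go (≤′-step n₀≤′M) = ≡.trans (step (≤′⇒≤ n₀≤′M)) (go n₀≤′M)

left-inverse : ExcludedMiddle 0ℓ → {G : Set} (e : G → ℕ) → Injective _≡_ _≡_ e → G →
               Σ (ℕ → G) λ a → ∀ x → a (e x) ≡ x
left-inverse em {G} e e-inj x₀ = a , a∘e
  where
  a : ℕ → G
  a j with em {Σ G λ y → e y ≡ j}
  ... | yes (y , _) = y
  ... | no _        = x₀
  a∘e : ∀ x → a (e x) ≡ x
  a∘e x with em {Σ G λ y → e y ≡ e x}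
  ... | yes (_ , ey≡ex) = e-inj ey≡ex
  ... | no ∄y          = ⊥-elim (∄y (x , ≡.refl))

module Orbits {G : Set} {𝒢 : FunSet G} (grp : IsPermGroup 𝒢) where
  open IsPermGroup grp
  open import Function.Endo.Propositional G using (_^_; ^-homo)

  infix 4 _~_
  _~_ : ∀ {n} → (Fin n → G) → (Fin n → G) → Set
  _~_ = SameOrbit 𝒢

  ~-refl : ∀ {n} {s : Fin n → G} → s ~ s
  ~-refl = id , has-id , λ _ → ≡.refl

  ~-sym : ∀ {n} {s t : Fin n → G} → s ~ t → t ~ s
  ~-sym {s = s} (α , α∈ , αs≗t) with β , β∈ , _ , βα≗id ← inverse α α∈ =
    β , β∈ , λ i → ≡.trans (cong β (≡.sym (αs≗t i))) (βα≗id (s i))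

  ~-trans : ∀ {n} {s t u : Fin n → G} → s ~ t → t ~ u → s ~ u
  ~-trans (α , α∈ , αs≗t) (β , β∈ , βt≗u) =
    β ∘ α , comp β α β∈ α∈ , λ i → ≡.trans (cong β (αs≗t i)) (βt≗u i)

  orbitSetoid : ℕ → Setoid 0ℓ 0ℓ
  orbitSetoid n = record
    { Carrier       = Fin n → G
    ; _≈_           = _~_
    ; isEquivalence = record { refl = ~-refl ; sym = ~-sym ; trans = ~-trans }
    }

  module ~-Reasoning {n} = Relation.Binary.Reasoning.Setoid (orbitSetoid n)

  PreservesOrbits : (G → G) → Set
  PreservesOrbits k = ∀ {n} {s t : Fin n → G} → s ~ t → k ∘ s ~ k ∘ t

  canonical⇒preservesOrbits : ∀ {g} → Canonical 𝒢 g → PreservesOrbits g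
  canonical⇒preservesOrbits {g} canonical {s = s} {t} (β , β∈ , βs≗t)
    with g′ , (α , α∈ , g′≗αgβ) , g′≈g ← canonical β β∈ (tabulate s) =
    ~-sym (α , α∈ , λ i → begin
      α (g (t i))        ≡⟨ cong (α ∘ g) (≡.sym (βs≗t i)) ⟩
      α (g (β (s i)))    ≡⟨ ≡.sym (g′≗αgβ (s i)) ⟩
      g′ (s i)           ≡⟨ g′≈g (s i) (∈-tabulate⁺ i) ⟩
      g (s i)            ∎)
    where open ≡.≡-Reasoning

  ^-preservesOrbits : ∀ {k} → PreservesOrbits k → ∀ p → PreservesOrbits (k ^ p)
  ^-preservesOrbits pk zero    s~t = s~t
  ^-preservesOrbits pk (suc p) s~t = pk (^-preservesOrbits pk p s~t)

  IdempotentAt : ℕ → (G → G) → Set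
  IdempotentAt n k = (t : Fin n → G) → k ∘ k ∘ t ~ k ∘ t

  idempotentAt-zero : ∀ k → IdempotentAt 0 k
  idempotentAt-zero k t = id , has-id , λ ()

  module _ {k n} (pk : PreservesOrbits k) (idem : IdempotentAt n k) where
    open ~-Reasoning

    ^-sameOrbit : ∀ q (t : Fin n → G) → (k ^ suc q) ∘ t ~ k ∘ t
    ^-sameOrbit zero    t = ~-refl
    ^-sameOrbit (suc q) t = begin
      k ∘ (k ^ suc q) ∘ t   ≈⟨ pk (^-sameOrbit q t) ⟩
      k ∘ k ∘ t             ≈⟨ idem t ⟩
      k ∘ t                 ∎

    ^-idempotentAt : ∀ q → IdempotentAt n (k ^ suc q)
    ^-idempotentAt q t = begin
      (k ^ suc q) ∘ (k ^ suc q) ∘ t   ≈⟨ ^-sameOrbit q ((k ^ suc q) ∘ t) ⟩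
      k ∘ (k ^ suc q) ∘ t             ≈⟨ pk (^-sameOrbit q t) ⟩
      k ∘ k ∘ t                       ≈⟨ idem t ⟩
      k ∘ t                           ≈⟨ ^-sameOrbit q t ⟨
      (k ^ suc q) ∘ t                 ∎

    idempotentAt⇒rigid : ∀ {γ} → 𝒢 γ → (t : Fin n → G) → k ∘ γ ∘ k ∘ t ~ k ∘ t
    idempotentAt⇒rigid {γ} γ∈ t = begin
      k ∘ (γ ∘ k ∘ t)   ≈⟨ pk (~-sym (γ , γ∈ , λ _ → ≡.refl)) ⟩
      k ∘ k ∘ t         ≈⟨ idem t ⟩
      k ∘ t             ∎

  orbitClassifier : Oligomorphic 𝒢 → ∀ {n} → 1 ≤ n →
                    Σ ℕ λ K → Σ ((Fin n → G) → Fin K) λ cls → ∀ {s t} → cls s ≡ cls t → s ~ t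
  orbitClassifier olig {n} n≥1 with reps , cover ← olig n n≥1 = length reps , cls , sound
    where
    rep : (Fin n → G) → Fin n → G
    rep t = proj₁ (cover t)
    rep∈ : ∀ t → rep t ∈ reps
    rep∈ t = proj₁ (proj₂ (cover t))
    rep~ : ∀ t → rep t ~ t
    rep~ t = proj₂ (proj₂ (cover t))
    cls : (Fin n → G) → Fin (length reps)
    cls t = index (rep∈ t)
    sound : ∀ {s t} → cls s ≡ cls t → s ~ t
    sound {s} {t} same = begin
      s                     ≈⟨ rep~ s ⟨
      rep s                 ≡⟨ lookup-index (rep∈ s) ⟩
      lookup reps (cls s)   ≡⟨ cong (lookup reps) same ⟩
      lookup reps (cls t)   ≡⟨ lookup-index (rep∈ t) ⟨
      rep t                 ≈⟨ rep~ t ⟩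
      t                     ∎
      where open ~-Reasoning

  idempotentAt-power : Oligomorphic 𝒢 → ∀ {k} → PreservesOrbits k → ∀ {n} → 1 ≤ n →
                       Σ ℕ λ q → IdempotentAt n (k ^ suc q)
  idempotentAt-power olig {k} pk {n} n≥1 with K , cls , sound ← orbitClassifier olig n≥1 =
    pred (K !) , ≡.subst (λ p → IdempotentAt n (k ^ p)) (≡.sym (suc-pred (K !) {{K !≢0}})) idem
    where
    open ~-Reasoning
    shift : (t : Fin n → G) → ShiftInvariant (orbitSetoid n) (λ i → (k ^ i) ∘ t)
    shift t d {i} {j} kⁱt~kʲt = begin
      (k ^ (d + i)) ∘ t         ≡⟨ cong (_∘ t) (^-homo k d i) ⟩
      (k ^ d) ∘ (k ^ i) ∘ t     ≈⟨ ^-preservesOrbits pk d kⁱt~kʲt ⟩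
      (k ^ d) ∘ (k ^ j) ∘ t     ≡⟨ cong (_∘ t) (^-homo k d j) ⟨
      (k ^ (d + j)) ∘ t         ∎
    idem : IdempotentAt n (k ^ (K !))
    idem t = begin
      (k ^ (K !)) ∘ (k ^ (K !)) ∘ t   ≡⟨ cong (_∘ t) (^-homo k (K !) (K !)) ⟨
      (k ^ (K ! + K !)) ∘ t           ≈⟨ u[n!+n!]≈u[n!] (orbitSetoid n) (shift t) cls sound ⟩
      (k ^ (K !)) ∘ t                 ∎

  rangeRigidOn : ∀ {h k α β} (F : List G) → PreservesOrbits k → IdempotentAt (length F) k →
                 𝒢 α → 𝒢 β → (∀ {y} → y ∈ F ++ map (β ∘ h) F → h y ≡ α (k y)) →
                 Σ (G → G) λ s → (Σ (G → G) λ α′ → 𝒢 α′ × (s ≗ α′ ∘ h ∘ β ∘ h)) ×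
                                 (∀ y → y ∈ F → s y ≡ h y)
  rangeRigidOn {h} {k} {α} {β} F pk idem α∈ β∈ h≈αk
    with γ , γ∈ , γkβαk≗k ← idempotentAt⇒rigid {k} pk idem (comp β α β∈ α∈) (lookup F)
       | α⁻¹ , α⁻¹∈ , _ , α⁻¹α≗id ← inverse α α∈ =
    α ∘ γ ∘ α⁻¹ ∘ h ∘ β ∘ h ,
    (α ∘ γ ∘ α⁻¹ , comp α (γ ∘ α⁻¹) α∈ (comp γ α⁻¹ γ∈ α⁻¹∈) , λ _ → ≡.refl) ,
    agree
    where
    open ≡.≡-Reasoning
    γ-fixes : ∀ {y} → y ∈ F → γ (k (β (α (k y)))) ≡ k y
    γ-fixes y∈F = ≡.subst (λ z → γ (k (β (α (k z)))) ≡ k z)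
                          (≡.sym (lookup-index y∈F)) (γkβαk≗k (index y∈F))
    agree : ∀ y → y ∈ F → α (γ (α⁻¹ (h (β (h y))))) ≡ h y
    agree y y∈F = begin
      α (γ (α⁻¹ (h (β (h y)))))       ≡⟨ cong (α ∘ γ ∘ α⁻¹) (h≈αk (∈-++⁺ʳ F (∈-map⁺ (β ∘ h) y∈F))) ⟩
      α (γ (α⁻¹ (α (k (β (h y))))))   ≡⟨ cong (α ∘ γ) (α⁻¹α≗id _) ⟩
      α (γ (k (β (h y))))             ≡⟨ cong (α ∘ γ ∘ k ∘ β) (h≈αk (∈-++⁺ˡ y∈F)) ⟩
      α (γ (k (β (α (k y)))))         ≡⟨ cong α (γ-fixes y∈F) ⟩
      α (k y)                         ≡⟨ h≈αk (∈-++⁺ˡ y∈F) ⟨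
      h y                             ∎

module _ {G : Set} {ℳ : FunSet G} (sg : IsTransSemigroup ℳ) where
  open import Function.Endo.Propositional G using (_^_)

  ^-closed : ∀ {k} → ℳ k → ∀ q → ℳ (k ^ suc q)
  ^-closed k∈ zero        = k∈
  ^-closed {k} k∈ (suc q) = sg k (k ^ suc q) k∈ (^-closed k∈ q)

module Construction {G : Set} (e : G → ℕ) (a : ℕ → G) (a∘e : ∀ x → a (e x) ≡ x)
  {𝒢 : FunSet G} (grp : IsPermGroup 𝒢) (olig : Oligomorphic 𝒢)
  {ℳ : FunSet G} (closed : Closed ℳ) (sg : IsTransSemigroup ℳ) (inv : Invariant 𝒢 ℳ)
  {g : G → G} (g∈ℳ : ℳ g) (g-canonical : Canonical 𝒢 g) where
  open IsPermGroup grp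
  open Orbits grp
  open import Function.Endo.Propositional G using (_^_)

  record Approximant : Set where
    field
      fun       : G → G
      fun∈ℳ     : ℳ fun
      preserves : PreservesOrbits fun

  power : Approximant → ℕ → Approximant
  power A q = record
    { fun       = fun ^ suc q
    ; fun∈ℳ     = ^-closed sg fun∈ℳ q
    ; preserves = ^-preservesOrbits {fun} preserves (suc q)
    }
    where open Approximant A

  approximant : ℕ → Approximant
  k : ℕ → G → G
  pk : ∀ N → PreservesOrbits (k N)
  exponent : ∀ N → Σ ℕ λ q → IdempotentAt (suc N) (k N ^ suc q)

  approximant zero    = record
    { fun = g ; fun∈ℳ = g∈ℳ ; preserves = canonical⇒preservesOrbits g-canonical }
  approximant (suc N) = power (approximant N) (proj₁ (exponent N))

  k N = Approximant.fun (approximant N)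

  pk N = Approximant.preserves (approximant N)

  exponent N = idempotentAt-power olig {k N} (pk N) (s≤s z≤n)

  k-idempotentAt : ∀ {n N} → n ≤ N → IdempotentAt n (k N)
  k-idempotentAt {N = zero}  z≤n  = idempotentAt-zero (k zero)
  k-idempotentAt {N = suc N} n≤1+N with m≤n⇒m<n∨m≡n n≤1+N
  ... | inj₂ ≡.refl = proj₂ (exponent N)
  ... | inj₁ n<1+N  =
    ^-idempotentAt {k N} (pk N) (k-idempotentAt (m<1+n⇒m≤n n<1+N)) (proj₁ (exponent N))

  initial : ∀ N → Fin (suc N) → G
  initial N i = a (toℕ i)

  correction : ∀ N → Σ (G → G) λ γ → 𝒢 γ ×
                 (γ ∘ k (suc (suc N)) ∘ initial N ≗ k (suc N) ∘ initial N)
  correction N = ^-sameOrbit {k (suc N)} (pk (suc N)) (k-idempotentAt ≤-refl)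
                   (proj₁ (exponent (suc N))) (initial N)

  γ : ℕ → G → G
  γ N = proj₁ (correction N)

  α : ℕ → Σ (G → G) 𝒢
  α zero    = id , has-id
  α (suc N) = proj₁ (α N) ∘ γ N , comp _ _ (proj₂ (α N)) (proj₁ (proj₂ (correction N)))

  H : ℕ → G → G
  H N = proj₁ (α N) ∘ k (suc N)

  H∈ℳ : ∀ N → ℳ (H N)
  H∈ℳ N = proj₁ (inv (proj₁ (α N)) (k (suc N)) (proj₂ (α N)) (Approximant.fun∈ℳ (approximant (suc N))))

  H-step : ∀ {x N} → e x ≤ N → H (suc N) x ≡ H N x
  H-step {x} {N} ex≤N = cong (proj₁ (α N))
    (≡.subst (λ z → γ N (k (suc (suc N)) z) ≡ k (suc N) z) initial≡x (proj₂ (proj₂ (correction N)) i))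
    where
    i = fromℕ< (s≤s ex≤N)
    initial≡x : initial N i ≡ x
    initial≡x = ≡.trans (cong a (toℕ-fromℕ< (s≤s ex≤N))) (a∘e x)

  h : G → G
  h x = H (e x) x

  h-agrees : ∀ {x N} → e x ≤ N → h x ≡ H N x
  h-agrees {x} ex≤N = ≡.sym (stationary (λ N → H N x) H-step ex≤N)

  ≤max : ∀ {x} n F → x ∈ F → e x ≤ max n (map e F)
  ≤max n F x∈F = All.lookup (xs≤max n (map e F)) (∈-map⁺ e x∈F)

  h∈ℳ : ℳ h
  h∈ℳ = closed h λ F → let N = max 0 (map e F) in
    H N , H∈ℳ N , λ x x∈F → ≡.sym (h-agrees {N = N} (≤max 0 F x∈F))

  h-rangeRigid : RangeRigid 𝒢 h
  h-rangeRigid β β∈ F =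
    rangeRigidOn {h} {k (suc N)} F (pk (suc N)) (k-idempotentAt {N = suc N} |F|≤1+N) (proj₂ (α N)) β∈
                 (λ y∈L → h-agrees {N = N} (≤max (length F) L y∈L))
    where
    L = F ++ map (β ∘ h) F
    N = max (length F) (map e L)
    |F|≤1+N : length F ≤ suc N
    |F|≤1+N = m≤n⇒m≤1+n (⊥≤max (length F) (map e L))

lemma3p10 : ExcludedMiddle 0ℓ →
    (G : Set) → Countable G →
    (𝒢 : FunSet G) → ClosedPermGroup 𝒢 → Oligomorphic 𝒢 →
    (ℳ : FunSet G) → NonEmpty ℳ → Closed ℳ → IsTransSemigroup ℳ → Invariant 𝒢 ℳ →
    Σ (G → G) (λ g → ℳ g × Canonical 𝒢 g) →
    Σ (G → G) (λ g → ℳ g × RangeRigid 𝒢 g)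
lemma3p10 em G (e , e-inj) 𝒢 (grp , _) olig ℳ _ closed sg inv (g , g∈ℳ , g-canonical)
  with em {G}
... | yes x₀ = h , h∈ℳ , h-rangeRigid
  where
  a = left-inverse em e e-inj x₀
  open Construction e (proj₁ a) (proj₂ a) grp olig closed sg inv g∈ℳ g-canonical
... | no ∄x = g , g∈ℳ , λ _ _ _ → g , (id , IsPermGroup.has-id grp , ⊥-elim ∘ ∄x) , ⊥-elim ∘ ∄x
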